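{- Let $T$ be a tree with $k$ edges such that, in the (unique up to swapping colors) proper vertex $2$-coloring of $T$, the leaves of $T$ do not all receive the same color. Then for every $n$, $\mathrm{ex}^c(n,T)\le (k-1)n$.
   Context: For a tree $T$, $\mathrm{ex}^c(n,T)$ denotes the maximum number of edges of an $n$-vertex graph $G$ that admits a proper vertex coloring (with any number of colors) such that in every copy of $T$ in $G$ (every subgraph of $G$ isomorphic to $T$), all leaves of that copy have the same color. -}

module Defs where

open import Data.Nat using (ℕ; zero; suc; _+_; _<ᵇ_; _≤_)
open import Data.Fin using (Fin; zero; suc; toℕ; inject₁; fromℕ)
open import Data.Bool using (Bool; true; false; if_then_else_; _∧_)
open import Data.Product using (Σ; ∃; ∃-syntax; _×_; _,_)
open import Function.Definitions using (Injective)
open import Relation.Binary.PropositionalEquality using (_≡_; _≢_)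
open import Relation.Nullary using (¬_)

record Graph (n : ℕ) : Set where
  field
    adj    : Fin n → Fin n → Bool
    sym    : ∀ i j → adj i j ≡ adj j i
    irrefl : ∀ i → adj i i ≡ false
open Graph public

Adj : ∀ {n} → Graph n → Fin n → Fin n → Set
Adj G i j = adj G i j ≡ true

sumF : ∀ {n} → (Fin n → ℕ) → ℕ
sumF {zero}  f = 0
sumF {suc n} f = f zero + sumF (λ i → f (suc i))

countF : ∀ {n} → (Fin n → Bool) → ℕ
countF p = sumF (λ i → if p i then 1 else 0)

degree : ∀ {n} → Graph n → Fin n → ℕ
degree G i = countF (adj G i)

edgeCount : ∀ {n} → Graph n → ℕ
edgeCount G = sumF (λ i → countF (λ j → adj G i j ∧ (toℕ i <ᵇ toℕ j)))

IsLeaf : ∀ {n} → Graph n → Fin n → Set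
IsLeaf G i = degree G i ≡ 1

data Reach {n} (G : Graph n) : Fin n → Fin n → Set where
  here : ∀ {u} → Reach G u u
  step : ∀ {u w v} → Adj G u w → Reach G w v → Reach G u v

Connected : ∀ {n} → Graph n → Set
Connected G = ∀ u v → Reach G u v

-- a cycle of length r+3: distinct vertices f 0, ..., f (r+2), consecutive adjacent,
-- and the last adjacent to the first
HasCycle : ∀ {n} → Graph n → Set
HasCycle {n} G = ∃[ r ] Σ (Fin (suc (suc (suc r))) → Fin n) λ f →
  Injective _≡_ _≡_ f ×
  (∀ (i : Fin (suc (suc r))) → Adj G (f (inject₁ i)) (f (suc i))) ×
  Adj G (f (fromℕ (suc (suc r)))) (f zero)

IsTree : ∀ {m} → Graph m → Set
IsTree {m} G = 1 ≤ m × Connected G × ¬ HasCycle G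

ProperColoring : ∀ {n} {C : Set} → Graph n → (Fin n → C) → Set
ProperColoring G c = ∀ u v → Adj G u v → c u ≢ c v

-- a copy of T in G: an injective map V(T) → V(G) sending edges of T to edges of G
-- (the image subgraph is isomorphic to T, and every such subgraph arises this way)
Embedding : ∀ {m n} → Graph m → Graph n → Set
Embedding {m} {n} T G = Σ (Fin m → Fin n) λ φ →
  Injective _≡_ _≡_ φ × (∀ i j → Adj T i j → Adj G (φ i) (φ j))

AdmitsLeafMonochromaticColoring : ∀ {m n} → Graph m → Graph n → Set
AdmitsLeafMonochromaticColoring T G =
  Σ (Fin _ → ℕ) λ c → ProperColoring G c ×
    (∀ (e : Embedding T G) (l l' : Fin _) → IsLeaf T l → IsLeaf T l' →
       c (Data.Product.proj₁ e l) ≡ c (Data.Product.proj₁ e l'))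

{-# OPTIONS --safe #-}
module Submission where

-- If G had more than (k − 1)·n edges, k = edgeCount T, then deleting vertices of degree at most
-- k − 1 one by one could not empty G: some nonempty S ⊆ V(G) induces a subgraph of minimum degree
-- at least k ≥ |T| − 1. There T embeds greedily, vertex by vertex from a prescribed root image,
-- even with some leaves postponed and some target vertices forbidden. Take leaves l, l′ on opposite
-- sides of the bipartition of T, with neighbours p, p′. Embedding T − {l, l′} with p ↦ x, then l′,
-- and finally l onto either of two neighbours z₁, z₂ of x gives two copies of T whose leaf colours
-- force c z₁ = c z₂. Hence on any copy of T inside S the colouring is constant on each side of the
-- bipartition of T, so l′ receives the colour of p, which differs from that of its neighbour l.

open import Defs hiding (sym)

open import Algebra.Properties.CommutativeSemigroup using (interchange)
open import Data.Bool using (Bool; true; false; not; _∧_; _∨_; if_then_else_)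
open import Data.Bool.Properties
  using (¬-not; ∨-zeroʳ; ∨-identityʳ; ∧-identityʳ; ∧-zeroʳ) renaming (_≟_ to _≟ᴮ_)
open import Data.Empty using (⊥; ⊥-elim)
open import Data.Fin using (Fin; zero; suc; toℕ; inject₁; fromℕ)
open import Data.Fin.Properties using (_≟_; any?)
open import Data.List using (List; []; _∷_; _++_; length; lookup)
open import Data.List.Properties using (length-++)
open import Data.List.Membership.Propositional using (_∈_; _∉_)
open import Data.List.Membership.Propositional.Properties using (∈-lookup; ∈-++⁺ˡ; ∈-++⁺ʳ)
import Data.List.Membership.DecPropositional as DecMembership
open import Data.List.Relation.Binary.Subset.Propositional using (_⊆_)
open import Data.List.Relation.Unary.Any using (here; there)
import Data.List.Relation.Unary.All as All
open import Data.List.Relation.Unary.All using (All; []; _∷_)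
open import Data.List.Relation.Unary.All.Properties using (¬Any⇒All¬; ++⁺)
open import Data.List.Relation.Unary.AllPairs using ([]; _∷_)
open import Data.List.Relation.Unary.Unique.Propositional using (Unique)
open import Data.Nat using (ℕ; zero; suc; _+_; _*_; _∸_; _≤_; _<_; z≤n; s≤s; _<ᵇ_; _≤?_)
open import Data.Nat.Properties hiding (_≟_; ≡ᵇ⇒≡)
open import Data.Nat.Solver using (module +-*-Solver)
open +-*-Solver using (solve; _:+_; _:*_; _:=_)
open import Data.Product using (Σ; ∃; ∃-syntax; _×_; _,_; proj₁; proj₂)
open import Data.Sum using (_⊎_; inj₁; inj₂)
open import Function using (case_of_; _∘_)
open import Relation.Binary.PropositionalEquality
open import Relation.Nullary using (¬_; yes; no; does)
open import Relation.Nullary.Decidable using (dec-true; dec-false; _×-dec_)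

⟦_⟧ : Bool → ℕ
⟦ b ⟧ = if b then 1 else 0

∧-true⁻ : ∀ {a b} → (a ∧ b) ≡ true → a ≡ true × b ≡ true
∧-true⁻ {true} {true} _ = refl , refl

≢∧≢⇒≡ : ∀ {a b c : Bool} → a ≢ b → c ≢ b → a ≡ c
≢∧≢⇒≡ a≢b c≢b = trans (¬-not a≢b) (sym (¬-not c≢b))

_≡ᵇ_ : ∀ {n} → Fin n → Fin n → Bool
i ≡ᵇ j = does (i ≟ j)

≡ᵇ-refl : ∀ {n} (i : Fin n) → (i ≡ᵇ i) ≡ true
≡ᵇ-refl i = dec-true (i ≟ i) refl

≢⇒≡ᵇ-false : ∀ {n} {i j : Fin n} → i ≢ j → (i ≡ᵇ j) ≡ false
≢⇒≡ᵇ-false {i = i} {j} = dec-false (i ≟ j)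

≡ᵇ⇒≡ : ∀ {n} {i j : Fin n} → (i ≡ᵇ j) ≡ true → i ≡ j
≡ᵇ⇒≡ {i = i} {j} eq with i ≟ j
... | yes i≡j = i≡j
≡ᵇ⇒≡ () | no _

sumF-cong : ∀ {n} {f g : Fin n → ℕ} → (∀ i → f i ≡ g i) → sumF f ≡ sumF g
sumF-cong {zero}  f≗g = refl
sumF-cong {suc n} f≗g = cong₂ _+_ (f≗g zero) (sumF-cong (λ i → f≗g (suc i)))

sumF-+ : ∀ {n} (f g : Fin n → ℕ) → sumF (λ i → f i + g i) ≡ sumF f + sumF g
sumF-+ {zero}  f g = refl
sumF-+ {suc n} f g = trans (cong (f zero + g zero +_) (sumF-+ (λ i → f (suc i)) (λ i → g (suc i))))
  (interchange +-commutativeSemigroup (f zero) (g zero) _ _)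

sumF-zero : ∀ {n} → sumF {n} (λ _ → 0) ≡ 0
sumF-zero {zero}  = refl
sumF-zero {suc n} = sumF-zero {n}

sumF-*ˡ : ∀ {n} a (f : Fin n → ℕ) → sumF (λ i → a * f i) ≡ a * sumF f
sumF-*ˡ {zero}  a f = sym (*-zeroʳ a)
sumF-*ˡ {suc n} a f = trans (cong (a * f zero +_) (sumF-*ˡ a (λ i → f (suc i))))
  (sym (*-distribˡ-+ a (f zero) _))

sumF-δ : ∀ {n} (v : Fin n) (f : Fin n → ℕ) → sumF (λ i → ⟦ i ≡ᵇ v ⟧ * f i) ≡ f v
sumF-δ {suc n} zero    f = trans (cong₂ _+_ (*-identityˡ (f zero)) (sumF-zero {n})) (+-identityʳ _)
sumF-δ {suc n} (suc v) f = sumF-δ v (λ i → f (suc i))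

VSet : ℕ → Set
VSet n = Fin n → Bool

∅ : ∀ {n} → VSet n
∅ _ = false

full : ∀ {n} → VSet n
full _ = true

insert : ∀ {n} → VSet n → Fin n → VSet n
insert X a i = X i ∨ (i ≡ᵇ a)

delete : ∀ {n} → VSet n → Fin n → VSet n
delete X a i = X i ∧ not (i ≡ᵇ a)

countF-cong : ∀ {n} {X Y : VSet n} → (∀ i → X i ≡ Y i) → countF X ≡ countF Y
countF-cong X≗Y = sumF-cong (λ i → cong ⟦_⟧ (X≗Y i))

countF-∅ : ∀ {n} → countF {n} ∅ ≡ 0
countF-∅ {n} = sumF-zero {n}

countF-full : ∀ {n} → countF {n} full ≡ n
countF-full {zero}  = refl
countF-full {suc n} = cong suc (countF-full {n})

countF-≤ : ∀ {n} (X : VSet n) → countF X ≤ n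
countF-≤ {zero}  X = z≤n
countF-≤ {suc n} X with X zero
... | true  = s≤s (countF-≤ (λ i → X (suc i)))
... | false = m≤n⇒m≤1+n (countF-≤ (λ i → X (suc i)))

countF-pick : ∀ {n} (X : VSet n) v → countF X ≡ countF (delete X v) + ⟦ X v ⟧
countF-pick X v = begin
  countF X
    ≡⟨ sumF-cong split ⟩
  sumF (λ i → ⟦ delete X v i ⟧ + ⟦ i ≡ᵇ v ⟧ * ⟦ X i ⟧)
    ≡⟨ sumF-+ (λ i → ⟦ delete X v i ⟧) _ ⟩
  countF (delete X v) + sumF (λ i → ⟦ i ≡ᵇ v ⟧ * ⟦ X i ⟧)
    ≡⟨ cong (countF (delete X v) +_) (sumF-δ v (λ i → ⟦ X i ⟧)) ⟩
  countF (delete X v) + ⟦ X v ⟧ ∎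
  where
  open ≡-Reasoning
  split : ∀ i → ⟦ X i ⟧ ≡ ⟦ delete X v i ⟧ + ⟦ i ≡ᵇ v ⟧ * ⟦ X i ⟧
  split i with i ≡ᵇ v | X i
  ... | true  | true  = refl
  ... | true  | false = refl
  ... | false | true  = refl
  ... | false | false = refl

insert-self : ∀ {n} (X : VSet n) a → insert X a a ≡ true
insert-self X a rewrite ≡ᵇ-refl a = ∨-zeroʳ (X a)

insert-⊇ : ∀ {n} (X : VSet n) a {i} → X i ≡ true → insert X a i ≡ true
insert-⊇ X a Xi rewrite Xi = refl

delete-insert : ∀ {n} (X : VSet n) {a} → X a ≡ false → ∀ i → delete (insert X a) a i ≡ X i
delete-insert X {a} Xa i with i ≟ a
... | yes refl rewrite Xa = refl
... | no  _    rewrite ∨-identityʳ (X i) = ∧-identityʳ (X i)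

countF-delete : ∀ {n} (X : VSet n) {v} → X v ≡ true → countF X ≡ suc (countF (delete X v))
countF-delete X {v} Xv = trans (countF-pick X v) (trans (cong (λ b → countF (delete X v) + ⟦ b ⟧) Xv) (+-comm _ 1))

countF-insert : ∀ {n} (X : VSet n) {a} → X a ≡ false → countF (insert X a) ≡ suc (countF X)
countF-insert X {a} Xa =
  trans (countF-delete (insert X a) (insert-self X a)) (cong suc (countF-cong (delete-insert X Xa)))

countF-≤-suc-delete : ∀ {n} (X : VSet n) v → countF X ≤ suc (countF (delete X v))
countF-≤-suc-delete X v = begin
  countF X                          ≡⟨ countF-pick X v ⟩
  countF (delete X v) + ⟦ X v ⟧     ≤⟨ +-monoʳ-≤ (countF (delete X v)) (⟦⟧≤1 (X v)) ⟩
  countF (delete X v) + 1           ≡⟨ +-comm _ 1 ⟩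
  suc (countF (delete X v))         ∎
  where
  open ≤-Reasoning
  ⟦⟧≤1 : ∀ b → ⟦ b ⟧ ≤ 1
  ⟦⟧≤1 true  = ≤-refl
  ⟦⟧≤1 false = z≤n

countF-pos : ∀ {n} (X : VSet n) → 0 < countF X → ∃ λ i → X i ≡ true
countF-pos {suc n} X pos with X zero in X0
... | true  = zero , X0
... | false with countF-pos (λ i → X (suc i)) pos
...   | i , Xi = suc i , Xi

∈⇒countF-pos : ∀ {n} (X : VSet n) {i} → X i ≡ true → 0 < countF X
∈⇒countF-pos X Xi = subst (0 <_) (sym (countF-delete X Xi)) (s≤s z≤n)

two≤countF : ∀ {n} (X : VSet n) {a b} → a ≢ b → X a ≡ true → X b ≡ true → 2 ≤ countF X
two≤countF X {a} {b} a≢b Xa Xb rewrite countF-delete X Xa = s≤s (∈⇒countF-pos (delete X a) Dab)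
  where
  Dab : delete X a b ≡ true
  Dab rewrite Xb | ≢⇒≡ᵇ-false (λ b≡a → a≢b (sym b≡a)) = refl

∃-outside : ∀ {n} (X : VSet n) (L : List (Fin n)) → length L < countF X → ∃ λ y → X y ≡ true × y ∉ L
∃-outside X [] pos with countF-pos X pos
... | y , Xy = y , Xy , λ ()
∃-outside X (x ∷ L) L<X
  with ∃-outside (delete X x) L (≤-pred (≤-trans L<X (countF-≤-suc-delete X x)))
... | y , Dy , y∉L with ∧-true⁻ {X y} Dy
...   | Xy , y≢ᵇx = y , Xy , λ
  { (here refl)  → case trans (sym y≢ᵇx) (cong not (≡ᵇ-refl y)) of λ ()
  ; (there y∈L) → y∉L y∈L }

countF≡0⇒∅ : ∀ {n} (X : VSet n) → countF X ≡ 0 → ∀ i → X i ≡ false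
countF≡0⇒∅ X |X|≡0 i with X i in Xi
... | true  = case trans (sym (countF-delete X Xi)) |X|≡0 of λ ()
... | false = refl

countF-disjoint : ∀ {n} (X Y : VSet n) → (∀ {i} → X i ≡ true → Y i ≡ false) → countF X + countF Y ≤ n
countF-disjoint {n} X Y disjoint =
  subst (_≤ n) (trans (sumF-cong ⟦∨⟧) (sumF-+ (λ i → ⟦ X i ⟧) (λ i → ⟦ Y i ⟧))) (countF-≤ (λ i → X i ∨ Y i))
  where
  ⟦∨⟧ : ∀ i → ⟦ X i ∨ Y i ⟧ ≡ ⟦ X i ⟧ + ⟦ Y i ⟧
  ⟦∨⟧ i with X i in Xi
  ... | true  rewrite disjoint Xi = refl
  ... | false = refl

insert⁻ : ∀ {n} (X : VSet n) {v x} → insert X v x ≡ true → x ≡ v ⊎ (X x ≡ true × x ≢ v)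
insert⁻ X {v} {x} X′x with x ≟ v
... | yes x≡v = inj₁ x≡v
... | no  x≢v rewrite ∨-identityʳ (X x) = inj₂ (X′x , x≢v)

adj-sym : ∀ {n} (G : Graph n) {a b} → Adj G a b → Adj G b a
adj-sym G {a} {b} e = trans (Graph.sym G b a) e

adj-irrefl : ∀ {n} (G : Graph n) {a b} → Adj G a b → a ≢ b
adj-irrefl G {a} e refl = case trans (sym e) (irrefl G a) of λ ()

edge< : ∀ {n} → Graph n → Fin n → Fin n → ℕ
edge< G i j = ⟦ adj G i j ∧ (toℕ i <ᵇ toℕ j) ⟧

edgesIn : ∀ {n} → Graph n → VSet n → ℕ
edgesIn G S = sumF λ i → sumF λ j → ⟦ S i ⟧ * (⟦ S j ⟧ * edge< G i j)

degIn : ∀ {n} → Graph n → VSet n → Fin n → ℕ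
degIn G S v = countF (λ j → adj G v j ∧ S j)

edgesIn-full : ∀ {n} (G : Graph n) → edgesIn G full ≡ edgeCount G
edgesIn-full {n} G = sumF-cong {n} λ i → sumF-cong {n} λ j → trans (*-identityˡ _) (*-identityˡ _)

edgesIn-∅ : ∀ {n} (G : Graph n) (S : VSet n) → (∀ i → S i ≡ false) → edgesIn G S ≡ 0
edgesIn-∅ {n} G S S≗∅ = trans (sumF-cong {n} row-zero) (sumF-zero {n})
  where
  row-zero : ∀ i → sumF (λ j → ⟦ S i ⟧ * (⟦ S j ⟧ * edge< G i j)) ≡ 0
  row-zero i rewrite S≗∅ i = sumF-zero {n}

edgesIn-cong : ∀ {n} (G : Graph n) {S S′ : VSet n} → (∀ i → S i ≡ S′ i) → edgesIn G S ≡ edgesIn G S′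
edgesIn-cong {n} G S≗S′ = sumF-cong {n} λ i → sumF-cong {n} λ j →
  cong₂ (λ a b → ⟦ a ⟧ * (⟦ b ⟧ * edge< G i j)) (S≗S′ i) (S≗S′ j)

<ᵇ-toℕ-xor : ∀ {n} (x y : Fin n) → x ≢ y →
  ((toℕ x <ᵇ toℕ y) ≡ true × (toℕ y <ᵇ toℕ x) ≡ false) ⊎
  ((toℕ x <ᵇ toℕ y) ≡ false × (toℕ y <ᵇ toℕ x) ≡ true)
<ᵇ-toℕ-xor zero    zero    x≢y = ⊥-elim (x≢y refl)
<ᵇ-toℕ-xor zero    (suc y) x≢y = inj₁ (refl , refl)
<ᵇ-toℕ-xor (suc x) zero    x≢y = inj₂ (refl , refl)
<ᵇ-toℕ-xor (suc x) (suc y) x≢y = <ᵇ-toℕ-xor x y (λ x≡y → x≢y (cong suc x≡y))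

edge<-pair : ∀ {n} (G : Graph n) {x y} → x ≢ y → edge< G x y + edge< G y x ≡ ⟦ adj G x y ⟧
edge<-pair G {x} {y} x≢y with <ᵇ-toℕ-xor x y x≢y
... | inj₁ (xy , yx)
  rewrite xy | yx | Graph.sym G y x | ∧-identityʳ (adj G x y) | ∧-zeroʳ (adj G x y) = +-identityʳ _
... | inj₂ (xy , yx)
  rewrite xy | yx | Graph.sym G y x | ∧-identityʳ (adj G x y) | ∧-zeroʳ (adj G x y) = refl

ΣΣ : ∀ {n} → (Fin n → Fin n → ℕ) → ℕ
ΣΣ f = sumF λ i → sumF λ j → f i j

ΣΣ-cong : ∀ {n} {f g : Fin n → Fin n → ℕ} → (∀ i j → f i j ≡ g i j) → ΣΣ f ≡ ΣΣ g
ΣΣ-cong f≗g = sumF-cong λ i → sumF-cong (f≗g i)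

ΣΣ-+ : ∀ {n} (f g : Fin n → Fin n → ℕ) → ΣΣ (λ i j → f i j + g i j) ≡ ΣΣ f + ΣΣ g
ΣΣ-+ f g = trans (sumF-cong λ i → sumF-+ (f i) (g i)) (sumF-+ (λ i → sumF (f i)) (λ i → sumF (g i)))

⟦∧⟧ : ∀ a b → ⟦ a ∧ b ⟧ ≡ ⟦ b ⟧ * ⟦ a ⟧
⟦∧⟧ true  true  = refl
⟦∧⟧ true  false = refl
⟦∧⟧ false b     = sym (*-zeroʳ ⟦ b ⟧)

-- Writing ⟦ S ⟧ = ⟦ S − v ⟧ + δᵥ in both indices of the double sum, the (S − v)² part is
-- edgesIn G (S − v), the two cross parts together count the edges at v, and δᵥ² leaves only the
-- loop term at v, which is 0.
module _ {n} (G : Graph n) (S : VSet n) {v : Fin n} (Sv : S v ≡ true) where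
  open ≡-Reasoning

  private
    e : Fin n → Fin n → ℕ
    e = edge< G

    s d : Fin n → ℕ
    s i = ⟦ delete S v i ⟧
    d i = ⟦ i ≡ᵇ v ⟧

    ⟦S⟧-split : ∀ i → ⟦ S i ⟧ ≡ s i + d i
    ⟦S⟧-split i with i ≟ v
    ... | yes refl rewrite Sv = refl
    ... | no  _    rewrite ∧-identityʳ (S i) = sym (+-identityʳ _)

    expand : ∀ i j → ⟦ S i ⟧ * (⟦ S j ⟧ * e i j) ≡
      (s i * (s j * e i j) + (s i * (d j * e i j) + d i * (s j * e i j))) + d i * (d j * e i j)
    expand i j rewrite ⟦S⟧-split i | ⟦S⟧-split j =
      solve 5 (λ a b c d′ x → (a :+ b) :* ((c :+ d′) :* x) :=
        (a :* (c :* x) :+ (a :* (d′ :* x) :+ b :* (c :* x))) :+ b :* (d′ :* x)) refl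
        (s i) (d i) (s j) (d j) (e i j)

    deg-split : ∀ j → ⟦ adj G v j ∧ S j ⟧ ≡ s j * e j v + s j * e v j
    deg-split j with j ≟ v
    ... | yes refl rewrite irrefl G j | ∧-zeroʳ (S j) = refl
    ... | no  j≢v  rewrite ∧-identityʳ (S j) =
      begin
        ⟦ adj G v j ∧ S j ⟧               ≡⟨ ⟦∧⟧ (adj G v j) (S j) ⟩
        ⟦ S j ⟧ * ⟦ adj G v j ⟧           ≡⟨ cong (λ a → ⟦ S j ⟧ * ⟦ a ⟧) (Graph.sym G v j) ⟩
        ⟦ S j ⟧ * ⟦ adj G j v ⟧           ≡⟨ cong (⟦ S j ⟧ *_) (sym (edge<-pair G j≢v)) ⟩
        ⟦ S j ⟧ * (e j v + e v j)         ≡⟨ *-distribˡ-+ ⟦ S j ⟧ (e j v) (e v j) ⟩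
        ⟦ S j ⟧ * e j v + ⟦ S j ⟧ * e v j ∎

    cross : ΣΣ (λ i j → s i * (d j * e i j) + d i * (s j * e i j)) ≡ degIn G S v
    cross = begin
      ΣΣ (λ i j → s i * (d j * e i j) + d i * (s j * e i j))
        ≡⟨ ΣΣ-+ {n} (λ i j → s i * (d j * e i j)) _ ⟩
      ΣΣ (λ i j → s i * (d j * e i j)) + ΣΣ (λ i j → d i * (s j * e i j))
        ≡⟨ cong₂ _+_ (sumF-cong {n} λ i → trans (sumF-*ˡ {n} (s i) _) (cong (s i *_) (sumF-δ v (e i))))
                     (trans (sumF-cong {n} λ i → sumF-*ˡ {n} (d i) _) (sumF-δ v (λ i → sumF λ j → s j * e i j))) ⟩
      sumF (λ j → s j * e j v) + sumF (λ j → s j * e v j)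
        ≡⟨ sym (trans (sumF-cong {n} deg-split) (sumF-+ {n} _ _)) ⟩
      degIn G S v ∎

    diagonal : ΣΣ (λ i j → d i * (d j * e i j)) ≡ 0
    diagonal = begin
      ΣΣ (λ i j → d i * (d j * e i j))
        ≡⟨ sumF-cong {n} (λ i → trans (sumF-*ˡ {n} (d i) _) (cong (d i *_) (sumF-δ v (e i)))) ⟩
      sumF (λ i → d i * e i v) ≡⟨ sumF-δ v (λ i → e i v) ⟩
      e v v                    ≡⟨ cong (λ a → ⟦ a ∧ _ ⟧) (irrefl G v) ⟩
      0 ∎

  edgesIn-delete : edgesIn G S ≡ edgesIn G (delete S v) + degIn G S v
  edgesIn-delete = begin
    edgesIn G S ≡⟨ ΣΣ-cong {n} expand ⟩
    ΣΣ (λ i j → (s i * (s j * e i j) + (s i * (d j * e i j) + d i * (s j * e i j))) + d i * (d j * e i j))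
      ≡⟨ trans (ΣΣ-+ {n} _ _) (cong₂ _+_ (ΣΣ-+ {n} _ _) diagonal) ⟩
    (edgesIn G (delete S v) + ΣΣ (λ i j → s i * (d j * e i j) + d i * (s j * e i j))) + 0
      ≡⟨ trans (+-identityʳ _) (cong (edgesIn G (delete S v) +_) cross) ⟩
    edgesIn G (delete S v) + degIn G S v ∎

Degenerate : ∀ {n} → Graph n → ℕ → Set
Degenerate {n} G D = ∀ (S : VSet n) v → S v ≡ true → ∃ λ w → S w ≡ true × degIn G S w ≤ D

degenerate⇒edgesIn≤ : ∀ {n} (G : Graph n) {D} → Degenerate G D → ∀ S → edgesIn G S ≤ D * countF S
degenerate⇒edgesIn≤ G {D} degenerate S = go (countF S) S refl
  where
  go : ∀ k S → countF S ≡ k → edgesIn G S ≤ D * countF S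
  go zero S |S|≡0 = subst (_≤ D * countF S) (sym (edgesIn-∅ G S (countF≡0⇒∅ S |S|≡0))) z≤n
  go (suc k) S |S|≡1+k with countF-pos S (subst (0 <_) (sym |S|≡1+k) (s≤s z≤n))
  ... | v , Sv with degenerate S v Sv
  ...   | w , Sw , deg≤D = begin
    edgesIn G S                           ≡⟨ edgesIn-delete G S Sw ⟩
    edgesIn G (delete S w) + degIn G S w  ≤⟨ +-mono-≤ (go k (delete S w) |S-w|≡k) deg≤D ⟩
    D * countF (delete S w) + D           ≡⟨ trans (+-comm _ D) (sym (*-suc D _)) ⟩
    D * suc (countF (delete S w))         ≡⟨ cong (D *_) (sym (countF-delete S Sw)) ⟩
    D * countF S                          ∎
    where
    open ≤-Reasoning
    |S-w|≡k : countF (delete S w) ≡ k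
    |S-w|≡k = suc-injective (trans (sym (countF-delete S Sw)) |S|≡1+k)

degenerate⇒edgeCount≤ : ∀ {n} (G : Graph n) {D} → Degenerate G D → edgeCount G ≤ D * n
degenerate⇒edgeCount≤ {n} G {D} degenerate =
  subst₂ _≤_ (edgesIn-full G) (cong (D *_) (countF-full {n})) (degenerate⇒edgesIn≤ G degenerate full)

saturate : ∀ {m} (P : VSet m → Set) (B : VSet m) →
  (∀ X → P X → ∀ y → X y ≡ false → B y ≡ false → ∃ λ v → X v ≡ false × P (insert X v)) →
  ∀ X → P X → ∃ λ X′ → P X′ × (∀ y → B y ≡ false → X′ y ≡ true)
saturate {m} P B extend X PX = go m X PX (m≤n+m m (countF X))
  where
  go : ∀ fuel X → P X → m ≤ countF X + fuel → ∃ λ X′ → P X′ × (∀ y → B y ≡ false → X′ y ≡ true)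
  go fuel X PX m≤ with any? (λ y → (X y ≟ᴮ false) ×-dec (B y ≟ᴮ false))
  ... | no  ∄y = X , PX , covered
    where
    covered : ∀ y → B y ≡ false → X y ≡ true
    covered y By with X y in Xy
    ... | true  = refl
    ... | false = ⊥-elim (∄y (y , Xy , By))
  ... | yes (y , Xy , By) with extend X PX y Xy By
  ...   | v , Xv , PXv with fuel
  ...     | zero = ⊥-elim (<⇒≱ (subst (_≤ m) (countF-insert X Xv) (countF-≤ (insert X v)))
                                (subst (m ≤_) (+-identityʳ _) m≤))
  ...     | suc fuel′ = go fuel′ (insert X v) PXv
                          (subst (m ≤_) (trans (+-suc _ fuel′) (cong (_+ fuel′) (sym (countF-insert X Xv)))) m≤)

lookup-injective : ∀ {a} {A : Set a} {xs : List A} → Unique xs → ∀ i j → lookup xs i ≡ lookup xs j → i ≡ j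
lookup-injective (_ ∷ _)  zero    zero    _  = refl
lookup-injective (x∉ ∷ _) zero    (suc j) eq = ⊥-elim (All.lookup x∉ (∈-lookup j) eq)
lookup-injective (x∉ ∷ _) (suc i) zero    eq = ⊥-elim (All.lookup x∉ (∈-lookup i) (sym eq))
lookup-injective (_ ∷ u)  (suc i) (suc j) eq = cong suc (lookup-injective u i j eq)

module _ {n} {G : Graph n} where
  open DecMembership (_≟_ {n}) using (_∈?_)


  later : ∀ {a b} → Reach G a b → List (Fin n)
  later here               = []
  later (step {w = c} _ w) = c ∷ later w

  vertices : ∀ {a b} → Reach G a b → List (Fin n)
  vertices {a} w = a ∷ later w

  _▻_ : ∀ {a b c} → Reach G a b → Reach G b c → Reach G a c
  here     ▻ w′ = w′
  step e w ▻ w′ = step e (w ▻ w′)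

  later-▻ : ∀ {a b c} (w : Reach G a b) (w′ : Reach G b c) → later (w ▻ w′) ≡ later w ++ later w′
  later-▻ here       w′ = refl
  later-▻ (step e w) w′ = cong (_ ∷_) (later-▻ w w′)

  reverse : ∀ {a b} → Reach G a b → Reach G b a
  reverse here       = here
  reverse (step e w) = reverse w ▻ step (adj-sym G e) here

  module _ {p} {P : Fin n → Set p} where

    All-▻ : ∀ {a b c} (w : Reach G a b) (w′ : Reach G b c) →
      All P (vertices w) → All P (vertices w′) → All P (vertices (w ▻ w′))
    All-▻ {a} w w′ Pw (_ ∷ Pw′) = subst (λ zs → All P (a ∷ zs)) (sym (later-▻ w w′)) (++⁺ Pw Pw′)

    All-reverse : ∀ {a b} (w : Reach G a b) → All P (vertices w) → All P (vertices (reverse w))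
    All-reverse here       Pw         = Pw
    All-reverse (step e w) (Pa ∷ Pw) =
      All-▻ (reverse w) (step (adj-sym G e) here) (All-reverse w Pw) (All.head Pw ∷ Pa ∷ [])

  crossing-edge : ∀ (X : VSet n) {s r} (w : Reach G s r) → X s ≡ false → X r ≡ true →
    ∃ λ a → ∃ λ b → a ∈ vertices w × X a ≡ false × X b ≡ true × Adj G a b
  crossing-edge X here                   Xs Xr = case trans (sym Xr) Xs of λ ()
  crossing-edge X (step {w = c} e w) Xs Xr with X c in Xc
  ... | true  = _ , c , here refl , Xs , Xc , e
  ... | false with crossing-edge X w Xc Xr
  ...   | a , b , a∈ , Xa , Xb , eab = a , b , there a∈ , Xa , Xb , eab

  suffix : ∀ {a b c} (w : Reach G c b) → a ∈ vertices w → Reach G a b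
  suffix w          (here refl) = w
  suffix (step e w) (there a∈)  = suffix w a∈

  suffix-⊆ : ∀ {a b c} (w : Reach G c b) (a∈ : a ∈ vertices w) → vertices (suffix w a∈) ⊆ vertices w
  suffix-⊆ w          (here refl) = λ x∈ → x∈
  suffix-⊆ (step e w) (there a∈)  = there ∘ suffix-⊆ w a∈

  suffix-unique : ∀ {a b c} (w : Reach G c b) (a∈ : a ∈ vertices w) →
    Unique (vertices w) → Unique (vertices (suffix w a∈))
  suffix-unique w          (here refl) u       = u
  suffix-unique (step e w) (there a∈)  (_ ∷ u) = suffix-unique w a∈ u

  loop-erase : ∀ {a b} (w : Reach G a b) →
    Σ (Reach G a b) λ w′ → Unique (vertices w′) × vertices w′ ⊆ vertices w
  loop-erase here = here , [] ∷ [] , λ x∈ → x∈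
  loop-erase {a} (step e w) with loop-erase w
  ... | w′ , u , w′⊆w with a ∈? vertices w′
  ...   | yes a∈ = suffix w′ a∈ , suffix-unique w′ a∈ u , there ∘ w′⊆w ∘ suffix-⊆ w′ a∈
  ...   | no  a∉ = step e w′ , ¬Any⇒All¬ _ a∉ ∷ u ,
    λ { (here refl) → here refl ; (there x∈) → there (w′⊆w x∈) }

  lookup-link : ∀ {a b} (w : Reach G a b) (i : Fin (length (later w))) →
    Adj G (lookup (vertices w) (inject₁ i)) (lookup (vertices w) (suc i))
  lookup-link (step e w) zero    = e
  lookup-link (step e w) (suc i) = lookup-link w i

  lookup-last : ∀ {a b} (w : Reach G a b) → lookup (vertices w) (fromℕ (length (later w))) ≡ b
  lookup-last here       = refl
  lookup-last (step e w) = lookup-last w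

  simple-closed-walk⇒cycle : ∀ {a b c d} (e₁ : Adj G a c) (e₂ : Adj G c d) (w : Reach G d b) →
    Unique (vertices (step e₁ (step e₂ w))) → Adj G b a → HasCycle G
  simple-closed-walk⇒cycle e₁ e₂ w u closing =
    length (later w) , lookup (vertices cyc) , (λ {i} {j} → lookup-injective u i j) , lookup-link cyc ,
    subst (λ x → Adj G x _) (sym (lookup-last cyc)) closing
    where
    cyc = step e₁ (step e₂ w)

  walk-around⇒cycle : ∀ {u x v} (w : Reach G u x) → v ∉ vertices w → u ≢ x →
    Adj G v u → Adj G x v → HasCycle G
  walk-around⇒cycle {v = v} w v∉w u≢x evu exv with loop-erase w
  ... | here       , _ , _    = ⊥-elim (u≢x refl)
  ... | step e w′ , u , w⊆ =
    simple-closed-walk⇒cycle evu e w′ (¬Any⇒All¬ _ (v∉w ∘ w⊆) ∷ u) exv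

connected⇒m∸1≤edgeCount : ∀ {m} (T : Graph m) → Connected T → m ∸ 1 ≤ edgeCount T
connected⇒m∸1≤edgeCount {zero}  T connected = z≤n
connected⇒m∸1≤edgeCount {suc m} T connected with saturate Rich ∅ extend X₀ (refl , |X₀|≤)
  where
  Rich : VSet (suc m) → Set
  Rich X = X zero ≡ true × countF X ≤ suc (edgesIn T X)

  X₀ : VSet (suc m)
  X₀ = insert ∅ zero

  |X₀|≤ : countF X₀ ≤ suc (edgesIn T X₀)
  |X₀|≤ = subst (_≤ suc (edgesIn T X₀))
    (sym (trans (countF-insert (∅ {suc m}) {zero} refl) (cong suc (countF-∅ {suc m})))) (s≤s z≤n)

  extend : ∀ X → Rich X → ∀ y → X y ≡ false → ∅ y ≡ false → ∃ λ v → X v ≡ false × Rich (insert X v)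
  extend X (X0 , |X|≤) y Xy _ with crossing-edge X (connected y zero) Xy X0
  ... | a , b , _ , Xa , Xb , eab = a , Xa , insert-⊇ X a X0 , (begin
    countF (insert X a)                         ≡⟨ countF-insert X Xa ⟩
    suc (countF X)                              ≤⟨ s≤s |X|≤ ⟩
    suc (suc (edgesIn T X))                     ≡⟨ cong suc (+-comm 1 _) ⟩
    suc (edgesIn T X + 1)                       ≤⟨ s≤s (+-monoʳ-≤ (edgesIn T X) a-has-neighbour) ⟩
    suc (edgesIn T X + degIn T (insert X a) a)
      ≡⟨ cong (λ k → suc (k + degIn T (insert X a) a)) (edgesIn-cong T (λ i → sym (delete-insert X Xa i))) ⟩
    suc (edgesIn T (delete (insert X a) a) + degIn T (insert X a) a)
      ≡⟨ cong suc (sym (edgesIn-delete T (insert X a) (insert-self X a))) ⟩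
    suc (edgesIn T (insert X a))                ∎)
    where
    open ≤-Reasoning
    a-has-neighbour : 1 ≤ degIn T (insert X a) a
    a-has-neighbour = ∈⇒countF-pos (λ j → adj T a j ∧ insert X a j)
      (subst (λ x → (adj T a b ∧ x) ≡ true) (sym (insert-⊇ X a Xb)) (trans (∧-identityʳ _) eab))
... | X , (_ , |X|≤) , X⊇full = ≤-pred (subst₂ (λ k e → k ≤ suc e) (trans (countF-cong X≗full) countF-full)
                                          (trans (edgesIn-cong T X≗full) (edgesIn-full T)) |X|≤)
  where
  X≗full : ∀ i → X i ≡ full i
  X≗full i = X⊇full i refl

module _ {m} (T : Graph m) where

  leaf-neighbour : ∀ {l} → IsLeaf T l → ∃ λ p → Adj T l p
  leaf-neighbour {l} leaf = countF-pos (adj T l) (subst (0 <_) (sym leaf) (s≤s z≤n))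

  leaf-neighbour-unique : ∀ {l x y} → IsLeaf T l → Adj T l x → Adj T l y → x ≡ y
  leaf-neighbour-unique {l} {x} {y} leaf elx ely with x ≟ y
  ... | yes x≡y = x≡y
  ... | no  x≢y = case subst (2 ≤_) leaf (two≤countF (adj T l) x≢y elx ely) of λ { (s≤s ()) }

  simple-walk-avoids-leaves : (B : VSet m) → (∀ {x} → B x ≡ true → IsLeaf T x) →
    ∀ {a b} (w : Reach T a b) → Unique (vertices w) → B a ≡ false → B b ≡ false →
    All (λ z → B z ≡ false) (vertices w)
  simple-walk-avoids-leaves B leaves here         _ Ba Bb = Ba ∷ []
  simple-walk-avoids-leaves B leaves (step e here) _ Ba Bb = Ba ∷ Bb ∷ []
  simple-walk-avoids-leaves B leaves (step {w = c} e₁ (step e₂ w)) (a∉ ∷ u) Ba Bb with B c in Bc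
  ... | true  = ⊥-elim (All.lookup a∉ (there (here refl)) (leaf-neighbour-unique (leaves Bc) (adj-sym T e₁) e₂))
  ... | false = Ba ∷ simple-walk-avoids-leaves B leaves (step e₂ w) u Bc Bb

  frontier : Connected T → (B : VSet m) → (∀ {x} → B x ≡ true → IsLeaf T x) → (X : VSet m) →
    ∀ {r y} → X r ≡ true → B r ≡ false → X y ≡ false → B y ≡ false →
    ∃ λ a → ∃ λ b → X a ≡ false × B a ≡ false × X b ≡ true × Adj T a b
  frontier connected B leaves X {r} {y} Xr Br Xy By with loop-erase (connected y r)
  ... | w , simple , _ with crossing-edge X w Xy Xr
  ...   | a , b , a∈w , Xa , Xb , eab =
    a , b , Xa , All.lookup (simple-walk-avoids-leaves B leaves w simple By Br) a∈w , Xb , eab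

image : ∀ {m n} → VSet m → (Fin m → Fin n) → List (Fin n)
image {zero}  X φ = []
image {suc m} X φ with X zero
... | true  = φ zero ∷ image (λ i → X (suc i)) (λ i → φ (suc i))
... | false = image (λ i → X (suc i)) (λ i → φ (suc i))

length-image : ∀ {m n} (X : VSet m) (φ : Fin m → Fin n) → length (image X φ) ≡ countF X
length-image {zero}  X φ = refl
length-image {suc m} X φ with X zero
... | true  = cong suc (length-image (λ i → X (suc i)) (λ i → φ (suc i)))
... | false = length-image (λ i → X (suc i)) (λ i → φ (suc i))

∈-image : ∀ {m n} (X : VSet m) (φ : Fin m → Fin n) {x} → X x ≡ true → φ x ∈ image X φ
∈-image {suc m} X φ {zero}  Xx with X zero
∈-image {suc m} X φ {zero}  Xx | true = here refl
∈-image {suc m} X φ {zero} () | false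
∈-image {suc m} X φ {suc x} Xx with X zero
... | true  = there (∈-image (λ i → X (suc i)) (λ i → φ (suc i)) Xx)
... | false = ∈-image (λ i → X (suc i)) (λ i → φ (suc i)) Xx

_[_↦_] : ∀ {m n} → (Fin m → Fin n) → Fin m → Fin n → Fin m → Fin n
(φ [ v ↦ y ]) i = if i ≡ᵇ v then y else φ i

↦-self : ∀ {m n} (φ : Fin m → Fin n) v y → (φ [ v ↦ y ]) v ≡ y
↦-self φ v y rewrite ≡ᵇ-refl v = refl

↦-other : ∀ {m n} (φ : Fin m → Fin n) {v x} y → x ≢ v → (φ [ v ↦ y ]) x ≡ φ x
↦-other φ y x≢v rewrite ≢⇒≡ᵇ-false x≢v = refl

module Greedy {m n} (T : Graph m) (G : Graph n) (S : VSet n) (D : ℕ)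
              (min-deg : ∀ {w} → S w ≡ true → D ≤ degIn G S w) where

  record PartialEmbedding (X : VSet m) (φ : Fin m → Fin n) : Set where
    field
      injective   : ∀ {x y} → X x ≡ true → X y ≡ true → φ x ≡ φ y → x ≡ y
      homomorphic : ∀ {x y} → X x ≡ true → X y ≡ true → Adj T x y → Adj G (φ x) (φ y)
      into-S      : ∀ {x} → X x ≡ true → S (φ x) ≡ true
  open PartialEmbedding public

  total⇒embedding : ∀ {X φ} → PartialEmbedding X φ → (∀ x → X x ≡ true) → Embedding T G
  total⇒embedding {X} {φ} pe total =
    φ , (λ {x} {y} → injective pe (total x) (total y)) , (λ x y → homomorphic pe (total x) (total y))

  extend : ∀ {X φ v u y} → PartialEmbedding X φ → X u ≡ true → Adj T v u →
    (∀ {x} → X x ≡ true → Adj T v x → x ≡ u) →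
    Adj G (φ u) y → S y ≡ true → (∀ {x} → X x ≡ true → φ x ≢ y) →
    PartialEmbedding (insert X v) (φ [ v ↦ y ])
  extend {X} {φ} {v} {u} {y} pe Xu evu only-u euy Sy fresh = record
    { injective = inj ; homomorphic = hom ; into-S = into }
    where
    φ′ = φ [ v ↦ y ]
    inj : ∀ {x x′} → insert X v x ≡ true → insert X v x′ ≡ true → φ′ x ≡ φ′ x′ → x ≡ x′
    inj {x} {x′} X′x X′x′ eq with insert⁻ X X′x | insert⁻ X X′x′
    ... | inj₁ refl | inj₁ refl = refl
    ... | inj₁ refl | inj₂ (Xx′ , x′≢v) =
      ⊥-elim (fresh Xx′ (trans (sym (↦-other φ y x′≢v)) (trans (sym eq) (↦-self φ v y))))
    ... | inj₂ (Xx , x≢v) | inj₁ refl =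
      ⊥-elim (fresh Xx (trans (sym (↦-other φ y x≢v)) (trans eq (↦-self φ v y))))
    ... | inj₂ (Xx , x≢v) | inj₂ (Xx′ , x′≢v) =
      injective pe Xx Xx′ (trans (sym (↦-other φ y x≢v)) (trans eq (↦-other φ y x′≢v)))
    hom : ∀ {x x′} → insert X v x ≡ true → insert X v x′ ≡ true → Adj T x x′ → Adj G (φ′ x) (φ′ x′)
    hom {x} {x′} X′x X′x′ e with insert⁻ X X′x | insert⁻ X X′x′
    ... | inj₁ refl | inj₁ refl = ⊥-elim (adj-irrefl T e refl)
    ... | inj₁ refl | inj₂ (Xx′ , x′≢v)
      rewrite ↦-self φ v y | ↦-other φ y x′≢v | only-u Xx′ e = adj-sym G euy
    ... | inj₂ (Xx , x≢v) | inj₁ refl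
      rewrite ↦-self φ v y | ↦-other φ y x≢v | only-u Xx (adj-sym T e) = euy
    ... | inj₂ (Xx , x≢v) | inj₂ (Xx′ , x′≢v)
      rewrite ↦-other φ y x≢v | ↦-other φ y x′≢v = homomorphic pe Xx Xx′ e
    into : ∀ {x} → insert X v x ≡ true → S (φ′ x) ≡ true
    into {x} X′x with insert⁻ X X′x
    ... | inj₁ refl rewrite ↦-self φ v y = Sy
    ... | inj₂ (Xx , x≢v) rewrite ↦-other φ y x≢v = into-S pe Xx

  fresh-neighbour : ∀ {X φ u} → PartialEmbedding X φ → X u ≡ true → (F : List (Fin n)) →
    countF X + length F ≤ D →
    ∃ λ y → Adj G (φ u) y × S y ≡ true × (∀ {x} → X x ≡ true → φ x ≢ y) × y ∉ F
  fresh-neighbour {X} {φ} {u} pe Xu F |X|+|F|≤D = pick (∃-outside (insert candidates (φ u)) used room)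
    where
    candidates : VSet n
    candidates y = adj G (φ u) y ∧ S y
    used : List (Fin n)
    used = image X φ ++ F
    φu∉candidates : candidates (φ u) ≡ false
    φu∉candidates = cong (_∧ S (φ u)) (irrefl G (φ u))
    room : length used < countF (insert candidates (φ u))
    room = begin-strict
      length used                      ≡⟨ trans (length-++ (image X φ)) (cong (_+ length F) (length-image X φ)) ⟩
      countF X + length F              ≤⟨ |X|+|F|≤D ⟩
      D                                ≤⟨ min-deg (into-S pe Xu) ⟩
      countF candidates                <⟨ n<1+n _ ⟩
      suc (countF candidates)          ≡⟨ sym (countF-insert candidates φu∉candidates) ⟩
      countF (insert candidates (φ u)) ∎
      where open ≤-Reasoning
    pick : (∃ λ y → insert candidates (φ u) y ≡ true × y ∉ used) →
      ∃ λ y → Adj G (φ u) y × S y ≡ true × (∀ {x} → X x ≡ true → φ x ≢ y) × y ∉ F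
    pick (y , c′y , y∉used) with insert⁻ candidates c′y
    ... | inj₁ refl = ⊥-elim (y∉used (∈-++⁺ˡ (∈-image X φ Xu)))
    ... | inj₂ (cy , _) with ∧-true⁻ {adj G (φ u) y} cy
    ...   | euy , Sy = y , euy , Sy ,
      (λ Xx φx≡y → y∉used (∈-++⁺ˡ (subst (_∈ image X φ) φx≡y (∈-image X φ Xx)))) ,
      y∉used ∘ ∈-++⁺ʳ (image X φ)

  module Grow (connected : Connected T) (acyclic : ¬ HasCycle T)
              (r : Fin m) (w : Fin n) (B : VSet m) (F : List (Fin n))
              (Sw : S w ≡ true) (Br : B r ≡ false) (w∉F : w ∉ F)
              (leaves : ∀ {x} → B x ≡ true → IsLeaf T x)
              (room : m + length F ≤ suc (D + countF B)) where

    record Grown (X : VSet m) (φ : Fin m → Fin n) : Set where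
      field
        partial    : PartialEmbedding X φ
        root∈      : X r ≡ true
        root↦      : φ r ≡ w
        reach-root : ∀ {x} → X x ≡ true → Σ (Reach T x r) λ p → All (λ z → X z ≡ true) (vertices p)
        avoids-B   : ∀ {x} → X x ≡ true → B x ≡ false
        avoids-F   : ∀ {x} → X x ≡ true → φ x ∉ F
    open Grown

    start : Grown (insert ∅ r) (λ _ → w)
    start = record
      { partial    = record
        { injective   = λ Xx Xy _ → trans (≡ᵇ⇒≡ Xx) (sym (≡ᵇ⇒≡ Xy))
        ; homomorphic = λ Xx Xy e → ⊥-elim (adj-irrefl T e (trans (≡ᵇ⇒≡ Xx) (sym (≡ᵇ⇒≡ Xy))))
        ; into-S      = λ _ → Sw }
      ; root∈      = insert-self ∅ r
      ; root↦      = refl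
      ; reach-root = λ Xx → subst (λ x → Σ (Reach T x r) λ p → All (λ z → insert ∅ r z ≡ true) (vertices p))
                                  (sym (≡ᵇ⇒≡ Xx)) (here , insert-self ∅ r ∷ [])
      ; avoids-B   = λ Xx → subst (λ x → B x ≡ false) (sym (≡ᵇ⇒≡ Xx)) Br
      ; avoids-F   = λ _ → w∉F }

    only-neighbour : ∀ {X φ v u x} → Grown X φ → X v ≡ false → X u ≡ true → X x ≡ true →
      Adj T v u → Adj T v x → x ≡ u
    only-neighbour {X} {v = v} {u} {x} g Xv Xu Xx evu evx with x ≟ u
    ... | yes x≡u = x≡u
    ... | no  x≢u with reach-root g Xu | reach-root g Xx
    ...   | pu , Xpu | px , Xpx =
      ⊥-elim (acyclic (walk-around⇒cycle (pu ▻ reverse px) v∉ (λ u≡x → x≢u (sym u≡x)) evu (adj-sym T evx)))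
      where
      v∉ : v ∉ vertices (pu ▻ reverse px)
      v∉ v∈ = case trans (sym (All.lookup (All-▻ pu (reverse px) Xpu (All-reverse px Xpx)) v∈)) Xv of λ ()

    |X|+|F|≤D : ∀ {X v} → (∀ {x} → X x ≡ true → B x ≡ false) → X v ≡ false → B v ≡ false →
      countF X + length F ≤ D
    |X|+|F|≤D {X} {v} X∩B=∅ Xv Bv = +-cancelʳ-≤ (countF B) _ _ (≤-pred (begin
      suc (countF X + length F + countF B)   ≡⟨ cong suc (+-comm (countF X + length F) _) ⟩
      suc (countF B + (countF X + length F)) ≡⟨ cong suc (sym (+-assoc (countF B) _ _)) ⟩
      suc (countF B + countF X + length F)   ≡⟨ cong (λ k → suc (k + length F)) (+-comm (countF B) _) ⟩
      suc (countF X + countF B) + length F   ≡⟨ cong (λ k → k + countF B + length F) (sym (countF-insert X Xv)) ⟩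
      countF (insert X v) + countF B + length F ≤⟨ +-monoˡ-≤ (length F) (countF-disjoint (insert X v) B disjoint) ⟩
      m + length F                          ≤⟨ room ⟩
      suc (D + countF B)                    ∎))
      where
      open ≤-Reasoning
      disjoint : ∀ {i} → insert X v i ≡ true → B i ≡ false
      disjoint X′i with insert⁻ X X′i
      ... | inj₁ refl     = Bv
      ... | inj₂ (Xi , _) = X∩B=∅ Xi

    grow-step : ∀ X → Σ (Fin m → Fin n) (Grown X) → ∀ y → X y ≡ false → B y ≡ false →
      ∃ λ v → X v ≡ false × Σ (Fin m → Fin n) (Grown (insert X v))
    grow-step X (φ , g) y Xy By with frontier T connected B leaves X (root∈ g) Br Xy By
    ... | a , b , Xa , Ba , Xb , eab with fresh-neighbour (partial g) Xb F (|X|+|F|≤D (avoids-B g) Xa Ba)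
    ...   | y′ , eby′ , Sy′ , fresh , y′∉F = a , Xa , φ [ a ↦ y′ ] , record
      { partial    = extend (partial g) Xb eab (λ Xx eax → only-neighbour g Xa Xb Xx eab eax) eby′ Sy′ fresh
      ; root∈      = insert-⊇ X a (root∈ g)
      ; root↦      = trans (↦-other φ y′ r≢a) (root↦ g)
      ; reach-root = reach
      ; avoids-B   = avoid-B
      ; avoids-F   = avoid-F }
      where
      r≢a : r ≢ a
      r≢a refl = case trans (sym (root∈ g)) Xa of λ ()
      reach : ∀ {x} → insert X a x ≡ true → Σ (Reach T x r) λ p → All (λ z → insert X a z ≡ true) (vertices p)
      reach X′x with insert⁻ X X′x
      ... | inj₁ refl with reach-root g Xb
      ...   | p , Xp = step eab p , insert-self X a ∷ All.map (insert-⊇ X a) Xp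
      reach X′x | inj₂ (Xx , _) with reach-root g Xx
      ...   | p , Xp = p , All.map (insert-⊇ X a) Xp
      avoid-B : ∀ {x} → insert X a x ≡ true → B x ≡ false
      avoid-B X′x with insert⁻ X X′x
      ... | inj₁ refl     = Ba
      ... | inj₂ (Xx , _) = avoids-B g Xx
      avoid-F : ∀ {x} → insert X a x ≡ true → (φ [ a ↦ y′ ]) x ∉ F
      avoid-F X′x with insert⁻ X X′x
      ... | inj₁ refl rewrite ↦-self φ a y′ = y′∉F
      ... | inj₂ (Xx , x≢a) rewrite ↦-other φ y′ x≢a = avoids-F g Xx

    grow : ∃ λ X → Σ (Fin m → Fin n) (Grown X) × (∀ y → B y ≡ false → X y ≡ true)
    grow = saturate (λ X → Σ (Fin m → Fin n) (Grown X)) B grow-step (insert ∅ r) (_ , start)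

module _ {m} {T : Graph m} {A : Set} (cT : Fin m → Bool) (proper : ProperColoring T cT) (f : Fin m → A)
         (common-neighbour : ∀ {a b c} → Adj T b a → Adj T b c → f a ≡ f c) where

  parity : ∀ {u v} → Reach T u v →
    (cT u ≡ cT v → f u ≡ f v) × (∀ {u′} → Adj T u′ u → cT u ≢ cT v → f u′ ≡ f v)
  parity here = (λ _ → refl) , (λ _ u≢u → ⊥-elim (u≢u refl))
  parity {u} {v} (step {w = c} e w) with parity w
  ... | same , differ =
    (λ u≡v → differ e (λ c≡v → proper u c e (trans u≡v (sym c≡v)))) ,
    (λ eu′u u≢v → trans (common-neighbour (adj-sym T eu′u) e)
                        (same (≢∧≢⇒≡ (≢-sym (proper u c e)) (≢-sym u≢v))))

module MinDegree {m n} (T : Graph m) (connected : Connected T) (acyclic : ¬ HasCycle T)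
                 (G : Graph n) (S : VSet n) (min-deg : ∀ {w} → S w ≡ true → m ∸ 1 ≤ degIn G S w) where
  open Greedy T G S (m ∸ 1) min-deg

  m≤1+[m∸1] : m ≤ suc (m ∸ 1)
  m≤1+[m∸1] = m≤n+m∸n m 1

  room-∅ : m + 0 ≤ suc (m ∸ 1 + countF (∅ {m}))
  room-∅ = subst₂ (λ a b → a ≤ suc b) (sym (+-identityʳ m))
                (sym (trans (cong (m ∸ 1 +_) (countF-∅ {m})) (+-identityʳ _))) m≤1+[m∸1]

  copy : ∀ {w} → S w ≡ true → Fin m → Σ (Embedding T G) λ e → ∀ x → S (proj₁ e x) ≡ true
  copy {w} Sw r =
    let (X , (_ , g) , covers) = grow
        total : ∀ x → X x ≡ true
        total x = covers x refl
    in total⇒embedding (Grown.partial g) total , λ x → into-S (Grown.partial g) (total x)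
    where open Grow connected acyclic r w ∅ [] Sw refl (λ ()) (λ ()) room-∅

  module _ (c : Fin n → ℕ)
           (leaf-mono : ∀ (e : Embedding T G) x x′ → IsLeaf T x → IsLeaf T x′ → c (proj₁ e x) ≡ c (proj₁ e x′))
           {l l′ p p′ : Fin m} (leaf : IsLeaf T l) (leaf′ : IsLeaf T l′) (lp : Adj T l p) (l′p′ : Adj T l′ p′)
           (l≢l′ : l ≢ l′) (l≁l′ : ¬ Adj T l l′) where

    private
      B : VSet m
      B = insert (insert ∅ l) l′

      B-l′ : insert ∅ l l′ ≡ false
      B-l′ = ≢⇒≡ᵇ-false (≢-sym l≢l′)

      B-outside : ∀ {x} → x ≢ l → x ≢ l′ → B x ≡ false
      B-outside x≢l x≢l′ rewrite ≢⇒≡ᵇ-false x≢l | ≢⇒≡ᵇ-false x≢l′ = refl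

      B⁻ : ∀ {x} → B x ≡ true → x ≡ l′ ⊎ x ≡ l
      B⁻ {x} Bx with insert⁻ (insert ∅ l) {l′} {x} Bx
      ... | inj₁ x≡l′      = inj₁ x≡l′
      ... | inj₂ (Bx′ , _) = inj₂ (≡ᵇ⇒≡ Bx′)

      B⊆leaves : ∀ {x} → B x ≡ true → IsLeaf T x
      B⊆leaves {x} Bx with B⁻ {x} Bx
      ... | inj₁ refl = leaf′
      ... | inj₂ refl = leaf

      |B|≡2 : countF B ≡ 2
      |B|≡2 = trans (countF-insert (insert ∅ l) B-l′)
                    (cong suc (trans (countF-insert ∅ {l} refl) (cong suc (countF-∅ {m}))))

      room-B : m + 2 ≤ suc (m ∸ 1 + countF B)
      room-B rewrite |B|≡2 = +-monoˡ-≤ 2 m≤1+[m∸1]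

      Bp : B p ≡ false
      Bp = B-outside (≢-sym (adj-irrefl T lp)) (λ p≡l′ → l≁l′ (subst (Adj T l) p≡l′ lp))

      Bp′ : B p′ ≡ false
      Bp′ = B-outside (λ p′≡l → l≁l′ (adj-sym T (subst (Adj T l′) p′≡l l′p′))) (≢-sym (adj-irrefl T l′p′))

    -- With minimum degree only m − 1, T − {l, l′} is the largest subtree that can still avoid both
    -- z₁ and z₂; l′ then avoids z₁ only, and z₂ is free for l unless l′ took it.
    module _ {x z₁ z₂} (Sx : S x ≡ true) (xz₁ : Adj G x z₁) (Sz₁ : S z₁ ≡ true)
                       (xz₂ : Adj G x z₂) (Sz₂ : S z₂ ≡ true) where
      private
        F : List (Fin n)
        F = z₁ ∷ z₂ ∷ []

        x∉F : x ∉ F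
        x∉F (here x≡z₁)         = adj-irrefl G xz₁ x≡z₁
        x∉F (there (here x≡z₂)) = adj-irrefl G xz₂ x≡z₂

      open Grow connected acyclic p x B F Sx Bp x∉F B⊆leaves room-B

      completion : ∀ {X φ} → Grown X φ → (∀ y → B y ≡ false → X y ≡ true) → c z₁ ≡ c z₂
      completion {X} {φ} g covers = same-colour
        where
        open Grown g

        |X|+1≤m∸1 : countF X + 1 ≤ m ∸ 1
        |X|+1≤m∸1 = subst (_≤ m ∸ 1) (+-∸-assoc (countF X) (s≤s z≤n))
          (∸-monoˡ-≤ 1 (subst (λ k → countF X + k ≤ m) |B|≡2 (countF-disjoint X B avoids-B)))

        fresh-y′ : ∃ λ y → Adj G (φ p′) y × S y ≡ true × (∀ {x} → X x ≡ true → φ x ≢ y) × y ∉ z₁ ∷ []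
        fresh-y′ = fresh-neighbour partial (covers p′ Bp′) (z₁ ∷ []) |X|+1≤m∸1

        y′ : Fin n
        y′ = proj₁ fresh-y′

        y′≢z₁ : y′ ≢ z₁
        y′≢z₁ y′≡z₁ = proj₂ (proj₂ (proj₂ (proj₂ fresh-y′))) (here y′≡z₁)

        φ₁ : Fin m → Fin n
        φ₁ = φ [ l′ ↦ y′ ]

        pe₁ : PartialEmbedding (insert X l′) φ₁
        pe₁ = let (_ , p′y′ , Sy′ , fresh , _) = fresh-y′ in
          extend partial (covers p′ Bp′) l′p′ (λ _ e → leaf-neighbour-unique T leaf′ e l′p′) p′y′ Sy′ fresh

        φ₁p : φ₁ p ≡ x
        φ₁p = trans (↦-other φ y′ (λ p≡l′ → l≁l′ (subst (Adj T l) p≡l′ lp))) root↦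

        total : ∀ t → insert (insert X l′) l t ≡ true
        total t with B t in Bt
        ... | false = insert-⊇ (insert X l′) l (insert-⊇ X l′ (covers t Bt))
        ... | true with B⁻ {t} Bt
        ...   | inj₁ refl = insert-⊇ (insert X l′) l (insert-self X l′)
        ...   | inj₂ refl = insert-self (insert X l′) l

        colour-l↦ : ∀ {z} → z ∈ F → y′ ≢ z → Adj G x z → S z ≡ true → c z ≡ c y′
        colour-l↦ {z} z∈F y′≢z xz Sz =
          subst₂ (λ a b → c a ≡ c b) (↦-self φ₁ l z) (trans (↦-other φ₁ z (≢-sym l≢l′)) (↦-self φ l′ y′))
            (leaf-mono (total⇒embedding pe₂ total) l l′ leaf leaf′)
          where
          fresh-z : ∀ {t} → insert X l′ t ≡ true → φ₁ t ≢ z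
          fresh-z X₁t with insert⁻ X X₁t
          ... | inj₁ refl rewrite ↦-self φ l′ y′ = y′≢z
          ... | inj₂ (Xt , t≢l′) rewrite ↦-other φ y′ t≢l′ =
            λ φt≡z → avoids-F Xt (subst (_∈ F) (sym φt≡z) z∈F)
          pe₂ : PartialEmbedding (insert (insert X l′) l) (φ₁ [ l ↦ z ])
          pe₂ = extend pe₁ (insert-⊇ X l′ root∈) lp (λ _ e → leaf-neighbour-unique T leaf e lp)
                       (subst (λ a → Adj G a z) (sym φ₁p) xz) Sz fresh-z

        same-colour : c z₁ ≡ c z₂
        same-colour with y′ ≟ z₂
        ... | yes y′≡z₂ = trans (colour-l↦ (here refl) y′≢z₁ xz₁ Sz₁) (cong c y′≡z₂)
        ... | no  y′≢z₂ = trans (colour-l↦ (here refl) y′≢z₁ xz₁ Sz₁)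
                                (sym (colour-l↦ (there (here refl)) y′≢z₂ xz₂ Sz₂))

      neighbours-same-colour : c z₁ ≡ c z₂
      neighbours-same-colour = let (_ , (_ , g) , covers) = grow in completion g covers

  no-nonempty-core : (c : Fin n → ℕ) → ProperColoring G c →
    (∀ (e : Embedding T G) x x′ → IsLeaf T x → IsLeaf T x′ → c (proj₁ e x) ≡ c (proj₁ e x′)) →
    (cT : Fin m → Bool) → ProperColoring T cT →
    ∀ {l l′} → IsLeaf T l → IsLeaf T l′ → cT l ≢ cT l′ → ∀ {w} → S w ≡ true → ⊥
  no-nonempty-core c proper leaf-mono cT properT {l} {l′} leaf leaf′ cl≢cl′ Sw with copy Sw l | adj T l l′ in ll′
  ... | e@(φ , _ , hom) , _    | true  = proper (φ l) (φ l′) (hom l l′ ll′) (leaf-mono e l l′ leaf leaf′)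
  ... | e@(φ , _ , hom) , into | false =
    proper (φ l) (φ p) (hom l p lp) (trans (leaf-mono e l l′ leaf leaf′) (sym cφp≡cφl′))
    where
    p  = proj₁ (leaf-neighbour T leaf)
    lp = proj₂ (leaf-neighbour T leaf)
    p′ = proj₁ (leaf-neighbour T leaf′)
    l′p′ = proj₂ (leaf-neighbour T leaf′)

    common-neighbour : ∀ {a b a′} → Adj T b a → Adj T b a′ → c (φ a) ≡ c (φ a′)
    common-neighbour {a} {b} {a′} ba ba′ =
      neighbours-same-colour c leaf-mono leaf leaf′ lp l′p′ (λ l≡l′ → cl≢cl′ (cong cT l≡l′))
        (λ e → case trans (sym e) ll′ of λ ()) (into b) (hom b a ba) (into a) (hom b a′ ba′) (into a′)

    cφp≡cφl′ : c (φ p) ≡ c (φ l′)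
    cφp≡cφl′ = proj₁ (parity cT properT (c ∘ φ) common-neighbour (connected p l′))
                     (≢∧≢⇒≡ (≢-sym (properT l p lp)) (≢-sym cl≢cl′))

theorem6 : ∀ {m} (T : Graph m) → IsTree T →
    (Σ (Fin m → Bool) λ c → ProperColoring T c ×
       ∃[ l ] ∃[ l' ] (IsLeaf T l × IsLeaf T l' × c l ≢ c l')) →
    ∀ n (G : Graph n) → AdmitsLeafMonochromaticColoring T G →
    edgeCount G ≤ (edgeCount T ∸ 1) * n
theorem6 {m} T (_ , connected , acyclic) (cT , properT , l , l′ , leaf , leaf′ , cl≢cl′)
         n G (c , proper , leaf-mono) =
  degenerate⇒edgeCount≤ G degenerate
  where
  degenerate : Degenerate G (edgeCount T ∸ 1)
  degenerate S v Sv with any? (λ w → (S w ≟ᴮ true) ×-dec (degIn G S w ≤? edgeCount T ∸ 1))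
  ... | yes sparse = sparse
  ... | no  ∄sparse = ⊥-elim (MinDegree.no-nonempty-core T connected acyclic G S min-deg
                                c proper leaf-mono cT properT leaf leaf′ cl≢cl′ Sv)
    where
    min-deg : ∀ {w} → S w ≡ true → m ∸ 1 ≤ degIn G S w
    min-deg {w} Sw = ≤-trans (connected⇒m∸1≤edgeCount T connected)
      (≤-trans (m≤n+m∸n (edgeCount T) 1) (≰⇒> (λ deg≤ → ∄sparse (w , Sw , deg≤))))
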